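{- Let $\alpha,\beta$ be relatively prime positive integers and $r\ge2$ an integer. For any integer $p\ge\beta$, there are at most $O(\beta^r)$ positive integers $n$ with $p(n)>p$, $n\le\frac{\beta(p-\beta+1)}{\alpha(\gamma-\lambda)^2}\gamma^{2r+2}$, and $t(n)>r$ (the implied constant not depending on $r$). Further, every positive integer $n$ with $p(n)>\beta$ and $n\le\beta g_r g_{r+1}$ satisfies $t(n)\le r$.
   Context: For positive integers $a_1,a_2$, the $(\alpha,\beta)$-walk $w_k(a_1,a_2)$ is the sequence with $w_1=a_1$, $w_2=a_2$, $w_{k+2}=\alpha w_{k+1}+\beta w_k$ for $k\ge1$. For a positive integer $n$, $s(n;a_1,a_2)$ is the (largest) index $s$ with $w_s(a_1,a_2)=n$ ($-\infty$ if none), and $s(n)=\max_{a_1,a_2\ge1}s(n;a_1,a_2)$. A pair $(a_1,a_2)$ is $n$-good if $a_1,a_2\ge1$ and $s(n;a_1,a_2)=s(n)$; $p(n)$ is the number of $n$-good pairs (possibly infinite). The sequence $g_k$ is defined by $g_1=1$, $g_2=\alpha$, $g_{k+2}=\alpha g_{k+1}+\beta g_k$. Let $\gamma=\frac12(\alpha+\sqrt{\alpha^2+4\beta})$, $\lambda=\frac12(\alpha-\sqrt{\alpha^2+4\beta})$. For $n$ with $s(n)>2$, $t(n)$ denotes the integer $t$ of the unique triple $(a,b,t)$ of integers with $n=a g_t+\beta b g_{t-1}$, $t\ge2$, $a\le(\beta-1)g_{t+1}+\alpha b$, $b\le g_t$, and $a-\alpha b-\ell g_{t+1}$ not a positive multiple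 of $\beta$ for any integer $\ell\ge0$; the paper proves this triple exists, is unique, and that $t(n)=s(n)-1$. Accordingly $t(n)=s(n)-1$ for all $n$. -}

module Defs where

open import Data.Nat using (ℕ; zero; suc; _+_; _*_; _∸_; _^_; _≤_; _<_)
open import Data.Product using (Σ; _×_; _,_; proj₁; proj₂; ∃-syntax)
open import Data.Fin using (Fin)
open import Function.Definitions using (Injective)
open import Relation.Binary.PropositionalEquality using (_≡_)

step : ℕ → ℕ → ℕ × ℕ → ℕ × ℕ
step α β (x , y) = (y , α * y + β * x)

iter : ℕ → ℕ → ℕ × ℕ → ℕ → ℕ × ℕ
iter α β p zero    = p
iter α β p (suc k) = step α β (iter α β p k)

-- (α,β)-walk, 1-indexed: walk α β a₁ a₂ 1 = a₁, walk α β a₁ a₂ 2 = a₂,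
-- walk (k+2) = α walk (k+1) + β walk k.  (Index 0 is a dummy value 0.)
walk : ℕ → ℕ → ℕ → ℕ → ℕ → ℕ
walk α β a₁ a₂ zero    = 0
walk α β a₁ a₂ (suc k) = proj₁ (iter α β (a₁ , a₂) k)

g : ℕ → ℕ → ℕ → ℕ
g α β k = proj₁ (iter α β (0 , 1) k)

IsS : ℕ → ℕ → ℕ → ℕ → Set
IsS α β n s =
  1 ≤ s
  × (∃[ a₁ ] ∃[ a₂ ] (1 ≤ a₁ × 1 ≤ a₂ × walk α β a₁ a₂ s ≡ n))
  × (∀ a₁ a₂ s' → 1 ≤ a₁ → 1 ≤ a₂ → 1 ≤ s' → walk α β a₁ a₂ s' ≡ n → s' ≤ s)

-- (a₁,a₂) is n-good: a₁,a₂ ≥ 1 and s(n;a₁,a₂) = s(n), i.e. the pair reaches n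
-- at the index s(n) (which is then necessarily its largest index with value n).
Good : ℕ → ℕ → ℕ → ℕ × ℕ → Set
Good α β n (a₁ , a₂) =
  1 ≤ a₁ × 1 ≤ a₂ × (∃[ s ] (IsS α β n s × walk α β a₁ a₂ s ≡ n))

-- p(n) > q  (p(n) possibly infinite): there are at least q+1 distinct n-good pairs.
PGt : ℕ → ℕ → ℕ → ℕ → Set
PGt α β n q =
  Σ (Fin (suc q) → ℕ × ℕ) λ f → Injective _≡_ _≡_ f × (∀ i → Good α β n (f i))

-- t(n) = s(n) - 1.
-- t(n) > r   ⇔  s(n) - 1 > r  ⇔  s(n) ≥ r + 2
TGt : ℕ → ℕ → ℕ → ℕ → Set
TGt α β n r = ∃[ s ] (IsS α β n s × suc (suc r) ≤ s)

-- t(n) ≤ r   ⇔  s(n) ≤ r + 1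
TLe : ℕ → ℕ → ℕ → ℕ → Set
TLe α β n r = ∃[ s ] (IsS α β n s × s ≤ suc r)

-- Exact comparison  x ≤ a + b·√d  for naturals x a b d.
-- (If x ≤ a this holds trivially; otherwise it is (x-a)² ≤ b² d.)
LeSqrt : ℕ → ℕ → ℕ → ℕ → Set
LeSqrt x a b d = (x ∸ a) ^ 2 ≤ b ^ 2 * d

-- Bound  n ≤ β (q - β + 1) / (α (γ - λ)²) · γ^(2r+2), written exactly.
-- With D = α² + 4β = (γ - λ)², one has γ^k = g_k γ + β g_{k-1}
--   = (α g_k + 2β g_{k-1} + g_k √D) / 2,
-- so with M = β (q - β + 1) and k = 2r+2 the bound is
--   2 α D n ≤ M (α g_k + 2 β g_{k-1}) + M g_k √D.
-- (Requires q ≥ β, so that q ∸ β is the true difference.)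
BoundN : ℕ → ℕ → ℕ → ℕ → ℕ → Set
BoundN α β q r n =
  let D = α ^ 2 + 4 * β
      M = β * ((q ∸ β) + 1)
      k = 2 * r + 2
  in LeSqrt (2 * α * D * n)
            (M * (α * g α β k + 2 * β * g α β (k ∸ 1)))
            (M * g α β k)
            D

AtMost : ℕ → (ℕ → Set) → Set
AtMost K P = ∀ m (f : Fin m → ℕ) → Injective _≡_ _≡_ f → (∀ i → P (f i)) → m ≤ K

{-# OPTIONS --safe #-}
-- Write s(n) = t + 2. Every n-good pair (a₁ , a₂) solves β g_t a₁ + g_{t+1} a₂ = n, and
-- β g_t and g_{t+1} are coprime, so q + 1 distinct good pairs force one with a₂ > q β g_t.
-- Sliding along the solution line gives a solution (A₁ , A₂) with A₁ ≤ β g_{t+1},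
-- A₂ > (q − β + 1) β g_t and A₂ ≡ α A₁ (mod β); maximality of s(n) then forces A₂ ≤ α A₁, whence
-- g_{t+2} (1 + (q − β + 1) β g_t) ≤ α n and q − β + 1 < α (α + β).  Since γ^{2r+2} ≤ lucas (2r+2),
-- which Cassini's identity writes as D g_{r+2} g_r + O(β^r), comparing with the upper bound on n
-- forces t = r and confines α D n to an interval of length O(β^r).  For the second part the
-- large solution alone gives n > β g_t g_{t+1} whenever t ≥ r.
module Submission where

open import Data.Empty using (⊥; ⊥-elim)
open import Data.Fin using (Fin; toℕ; fromℕ<) renaming (zero to fzero)
open import Data.Fin.Properties using (toℕ-fromℕ<; injective⇒≤; any?)
open import Data.Nat
open import Data.Nat.Coprimality as Coprime using (Coprime; coprime-divisor)
open import Data.Nat.Divisibility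
open import Data.Nat.DivMod using (m≡m%n+[m/n]*n; m%n<n; m/n*n≤m; m<n*o⇒m/o<n)
open import Data.Nat.GCD using (module Bézout)
open import Data.Nat.Properties
open import Data.Nat.Tactic.RingSolver using (solve-∀)
open import Data.Product
open import Data.Sum using (_⊎_; inj₁; inj₂; [_,_]′)
open import Function.Base using (case_of_)
open import Function.Definitions using (Injective)
open import Relation.Binary.PropositionalEquality
open import Relation.Nullary using (yes; no)

open import Defs

coprime-* : ∀ {a b c} → Coprime a c → Coprime b c → Coprime (a * b) c
coprime-* {a} a⊥c b⊥c {d} (d∣ab , d∣c) = b⊥c (coprime-divisor d⊥a d∣ab , d∣c)
  where
  d⊥a : Coprime d a
  d⊥a (e∣d , e∣a) = a⊥c (e∣a , ∣-trans e∣d d∣c)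

infix 4 _≡_mod_
_≡_mod_ : ℕ → ℕ → ℕ → Set
a ≡ b mod M = ∃₂ λ k l → a + k * M ≡ b + l * M

≡-mod-gap : ∀ {a b M} → a ≡ b mod M → b < a → ∃ λ d → a ≡ b + suc d * M
≡-mod-gap {a} {b} {M} (k , l , eq) b<a with l ≤? k
... | yes l≤k = ⊥-elim (<⇒≱ (+-monoˡ-< (l * M) b<a) (begin
  a + l * M ≤⟨ +-monoʳ-≤ a (*-monoˡ-≤ M l≤k) ⟩
  a + k * M ≡⟨ eq ⟩
  b + l * M ∎))
  where open ≤-Reasoning
... | no l≰k = l ∸ suc k , +-cancelʳ-≡ (k * M) _ _ (begin
  a + k * M                          ≡⟨ eq ⟩
  b + l * M                          ≡⟨ cong (λ i → b + i * M) (sym (m+[n∸m]≡n (≰⇒> l≰k))) ⟩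
  b + (suc k + (l ∸ suc k)) * M      ≡⟨ regroup b k (l ∸ suc k) M ⟩
  b + suc (l ∸ suc k) * M + k * M    ∎)
  where
  open ≡-Reasoning
  regroup : ∀ b k d M → b + (suc k + d) * M ≡ b + suc d * M + k * M
  regroup = solve-∀

negative-inverse : ∀ {e β} → 1 ≤ β → Coprime e β → ∃₂ λ w k → e * w + 1 ≡ k * β
negative-inverse {e} {suc b} _ e⊥β with Coprime.coprime-Bézout e⊥β
... | Bézout.-+ x y eq = x , y , trans (+-comm (e * x) 1) (trans (cong (λ z → 1 + z) (*-comm e x)) eq)
... | Bézout.+- x y eq = x * b , 1 + y * b , (begin
  e * (x * b) + 1         ≡⟨ cong (_+ 1) (regroup₁ e x b) ⟩
  x * e * b + 1           ≡⟨ cong (λ z → z * b + 1) (sym eq) ⟩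
  (1 + y * suc b) * b + 1 ≡⟨ regroup₂ y b ⟩
  (1 + y * b) * suc b     ∎)
  where
  open ≡-Reasoning
  regroup₁ : ∀ e x b → e * (x * b) ≡ x * e * b
  regroup₁ = solve-∀
  regroup₂ : ∀ y b → (1 + y * (1 + b)) * b + 1 ≡ (1 + y * b) * (1 + b)
  regroup₂ = solve-∀

residue : ∀ {e β} → 1 ≤ β → Coprime e β → ∀ y a → ∃ λ j → j < β × y + j * e ≡ a mod β
residue {e} {suc b} 1≤β e⊥β y a with negative-inverse 1≤β e⊥β
... | w , k , ew+1≡kβ = N % suc b , m%n<n N (suc b) , e * (N / suc b) + a , k * S , (begin
  y + N % suc b * e + (e * (N / suc b) + a) * suc b ≡⟨ regroup₁ y e (N % suc b) (N / suc b) a b ⟩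
  y + e * (N % suc b + N / suc b * suc b) + a * suc b ≡⟨ cong (λ z → y + e * z + a * suc b) (sym (m≡m%n+[m/n]*n N (suc b))) ⟩
  y + e * (w * S) + a * suc b                       ≡⟨ regroup₂ y e w b a ⟩
  (e * w + 1) * S + a                               ≡⟨ cong (λ z → z * S + a) ew+1≡kβ ⟩
  k * suc b * S + a                                 ≡⟨ regroup₃ k b S a ⟩
  a + k * S * suc b                                 ∎)
  where
  open ≡-Reasoning
  -- S ≡ y - a mod β, so that y + e * (w * S) ≡ y - S ≡ a.
  S = y + b * a
  N = w * S
  regroup₁ : ∀ y e j Q a b → y + j * e + (e * Q + a) * (1 + b) ≡ y + e * (j + Q * (1 + b)) + a * (1 + b)
  regroup₁ = solve-∀
  regroup₂ : ∀ y e w b a → y + e * (w * (y + b * a)) + a * (1 + b) ≡ (e * w + 1) * (y + b * a) + a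
  regroup₂ = solve-∀
  regroup₃ : ∀ k b S a → k * (1 + b) * S + a ≡ a + k * S * (1 + b)
  regroup₃ = solve-∀

window-unique : ∀ {A B x x' y y'} → Coprime A B → A * x + B * y ≡ A * x' + B * y' →
                y ≤ y' → y' < y + A → y ≡ y'
window-unique {A} {B} {x} {x'} {y} {y'} A⊥B eq y≤y' y'<y+A with y' ∸ y | m+[n∸m]≡n y≤y'
... | zero  | refl = sym (+-identityʳ y)
... | suc d | refl = ⊥-elim (<⇒≱ (+-cancelˡ-< y _ _ y'<y+A) (∣⇒≤ A∣d))
  where
  regroup : ∀ A B x' y d → A * x' + B * (y + d) ≡ A * x' + B * d + B * y
  regroup = solve-∀
  Ax≡Ax'+Bd : x * A ≡ A * x' + B * suc d
  Ax≡Ax'+Bd = trans (*-comm x A) (+-cancelʳ-≡ (B * y) _ _ (trans eq (regroup A B x' y (suc d))))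
  A∣d : A ∣ suc d
  A∣d = coprime-divisor A⊥B (∣m+n∣m⇒∣n (divides x (sym Ax≡Ax'+Bd)) (∣m⇒∣m*n x' ∣-refl))

solution-unique : ∀ {A B x x' y y'} .{{_ : NonZero A}} → Coprime A B → A * x + B * y ≡ A * x' + B * y' →
                  y < y' + A → y' < y + A → (x , y) ≡ (x' , y')
solution-unique {A} {B} {x} {x'} {y} {y'} A⊥B eq y<y'+A y'<y+A = cong₂ _,_ x≡x' y≡y'
  where
  y≡y' : y ≡ y'
  y≡y' = [ (λ y≤y' → window-unique A⊥B eq y≤y' y'<y+A)
         , (λ y'≤y → sym (window-unique A⊥B (sym eq) y'≤y y<y'+A)) ]′ (≤-total y y')
  x≡x' : x ≡ x'
  x≡x' = *-cancelˡ-≡ x x' A (+-cancelʳ-≡ (B * y) _ _ (subst (λ z → A * x + B * y ≡ A * x' + B * z) (sym y≡y') eq))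

equal-quotients⇒close : ∀ a b M .{{_ : NonZero M}} → a / M ≡ b / M → a < b + M
equal-quotients⇒close a b M eq = begin-strict
  a                   ≡⟨ m≡m%n+[m/n]*n a M ⟩
  a % M + (a / M) * M <⟨ +-monoˡ-< _ (m%n<n a M) ⟩
  M + (a / M) * M     ≡⟨ cong (λ z → M + z * M) eq ⟩
  M + (b / M) * M     ≤⟨ +-monoʳ-≤ M (m/n*n≤m b M) ⟩
  M + b               ≡⟨ +-comm M b ⟩
  b + M               ∎
  where open ≤-Reasoning

large-solution : ∀ {A B n} q .{{_ : NonZero A}} → Coprime A B →
                 (f : Fin (suc q) → ℕ × ℕ) → Injective _≡_ _≡_ f →
                 (∀ i → 1 ≤ proj₂ (f i)) → (∀ i → A * proj₁ (f i) + B * proj₂ (f i) ≡ n) →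
                 ∃ λ i → q * A < proj₂ (f i)
large-solution {A} q A⊥B f f-inj 1≤y solves with any? (λ i → q * A <? proj₂ (f i))
... | yes large = large
... | no ¬large = ⊥-elim (<-irrefl refl (injective⇒≤ block-injective))
  where
  y : Fin (suc q) → ℕ
  y i = proj₂ (f i)
  block< : ∀ i → (y i ∸ 1) / A < q
  block< i = m<n*o⇒m/o<n (begin-strict
    y i ∸ 1 <⟨ ∸-monoʳ-< {o = 0} ≤-refl (1≤y i) ⟩
    y i     ≤⟨ ≮⇒≥ (λ qA<y → ¬large (i , qA<y)) ⟩
    q * A   ∎)
    where open ≤-Reasoning
  block : Fin (suc q) → Fin q
  block i = fromℕ< (block< i)
  close : ∀ i j → block i ≡ block j → y i < y j + A
  close i j eq = shift (1≤y i) (1≤y j) (equal-quotients⇒close (y i ∸ 1) (y j ∸ 1) A same-block)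
    where
    same-block : (y i ∸ 1) / A ≡ (y j ∸ 1) / A
    same-block = trans (sym (toℕ-fromℕ< (block< i))) (trans (cong toℕ eq) (toℕ-fromℕ< (block< j)))
    shift : ∀ {a b} → 1 ≤ a → 1 ≤ b → a ∸ 1 < b ∸ 1 + A → a < b + A
    shift {suc a} {suc b} _ _ = s<s
  block-injective : Injective _≡_ _≡_ block
  block-injective {i} {j} eq = f-inj (solution-unique A⊥B (trans (solves i) (sym (solves j)))
                                       (close i j eq) (close j i (sym eq)))

first-coordinate-≤ : ∀ A B {x y n} .{{_ : NonZero B}} → 1 ≤ x → A * x + B * y ≡ n →
                     ∃₂ λ x' y' → 1 ≤ x' × x' ≤ B × y ≤ y' × A * x' + B * y' ≡ n
first-coordinate-≤ A B {suc x} {y} _ eq =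
  suc (x % B) , y + x / B * A , s≤s z≤n , m%n<n x B , m≤m+n y _ , (begin
    A * suc (x % B) + B * (y + x / B * A) ≡⟨ regroup A B (x % B) (x / B) y ⟩
    A * suc (x % B + x / B * B) + B * y   ≡⟨ cong (λ z → A * suc z + B * y) (sym (m≡m%n+[m/n]*n x B)) ⟩
    A * suc x + B * y                     ≡⟨ eq ⟩
    _                                     ∎)
  where
  open ≡-Reasoning
  regroup : ∀ A B r d y → A * suc r + B * (y + d * A) ≡ A * suc (r + d * B) + B * y
  regroup = solve-∀

LeSqrt⇒≤+ : ∀ {x a b d} → d * (b * b) ≤ a * a → LeSqrt x a b d → x ≤ a + a
LeSqrt⇒≤+ {x} {a} {b} {d} db²≤a² x∸a²≤b²d = ≤-trans (m≤n+m∸n x a) (+-monoʳ-≤ a x∸a≤a)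
  where
  x∸a≤a : x ∸ a ≤ a
  x∸a≤a = ≮⇒≥ λ a<x∸a → <⇒≱ (*-mono-< a<x∸a a<x∸a) (begin
    (x ∸ a) * (x ∸ a) ≡⟨ cong ((x ∸ a) *_) (sym (*-identityʳ (x ∸ a))) ⟩
    (x ∸ a) ^ 2       ≤⟨ x∸a²≤b²d ⟩
    b ^ 2 * d         ≡⟨ regroup b d ⟩
    d * (b * b)       ≤⟨ db²≤a² ⟩
    a * a             ∎)
    where
    open ≤-Reasoning
    regroup : ∀ b d → b * (b * 1) * d ≡ d * (b * b)
    regroup = solve-∀

AtMost-window : ∀ {P : ℕ → Set} c B W .{{_ : NonZero c}} →
                (∀ n → P n → B < c * n × c * n ≤ B + W) → AtMost W P
AtMost-window c B W window m f f-inj Pf = injective⇒≤ offset-injective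
  where
  offset< : ∀ i → c * f i ∸ suc B < W
  offset< i = +-cancelˡ-≤ B _ _ (begin
    B + suc (c * f i ∸ suc B) ≡⟨ +-suc B _ ⟩
    suc B + (c * f i ∸ suc B) ≡⟨ m+[n∸m]≡n (proj₁ (window (f i) (Pf i))) ⟩
    c * f i                   ≤⟨ proj₂ (window (f i) (Pf i)) ⟩
    B + W                     ∎)
    where open ≤-Reasoning
  offset : Fin m → Fin W
  offset i = fromℕ< (offset< i)
  offset-injective : Injective _≡_ _≡_ offset
  offset-injective {i} {j} eq = f-inj (*-cancelˡ-≡ (f i) (f j) c (begin
    c * f i                       ≡⟨ sym (m∸n+n≡m (proj₁ (window (f i) (Pf i)))) ⟩
    (c * f i ∸ suc B) + suc B     ≡⟨ cong (_+ suc B) same-offset ⟩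
    (c * f j ∸ suc B) + suc B     ≡⟨ m∸n+n≡m (proj₁ (window (f j) (Pf j))) ⟩
    c * f j                       ∎))
    where
    open ≡-Reasoning
    same-offset : c * f i ∸ suc B ≡ c * f j ∸ suc B
    same-offset = trans (sym (toℕ-fromℕ< (offset< i))) (trans (cong toℕ eq) (toℕ-fromℕ< (offset< j)))

module Recurrence (α β : ℕ) where

  G : ℕ → ℕ
  G = g α β

  iter-suc : ∀ p k → iter α β p (suc k) ≡ iter α β (step α β p) k
  iter-suc p zero    = refl
  iter-suc p (suc k) = cong (step α β) (iter-suc p k)

  walk-prepend : ∀ a₀ a₁ k → walk α β a₀ a₁ (2 + k) ≡ walk α β a₁ (α * a₁ + β * a₀) (1 + k)
  walk-prepend a₀ a₁ k = cong proj₁ (iter-suc (a₀ , a₁) k)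

  walk-closed-form : ∀ a₁ a₂ k → walk α β a₁ a₂ (2 + k) ≡ β * G k * a₁ + G (1 + k) * a₂
  walk-closed-form a₁ a₂ zero = base β a₁ a₂
    where
    base : ∀ β a₁ a₂ → a₂ ≡ β * 0 * a₁ + 1 * a₂
    base = solve-∀
  walk-closed-form a₁ a₂ (suc k) = begin
    walk α β a₁ a₂ (3 + k)                              ≡⟨ walk-prepend a₁ a₂ (suc k) ⟩
    walk α β a₂ (α * a₂ + β * a₁) (2 + k)               ≡⟨ walk-closed-form a₂ _ k ⟩
    β * G k * a₂ + G (1 + k) * (α * a₂ + β * a₁)        ≡⟨ regroup α β a₁ a₂ (G k) (G (1 + k)) ⟩
    β * G (1 + k) * a₁ + (α * G (1 + k) + β * G k) * a₂ ∎
    where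
    open ≡-Reasoning
    regroup : ∀ α β a₁ a₂ x y → β * x * a₂ + y * (α * a₂ + β * a₁) ≡ β * y * a₁ + (α * y + β * x) * a₂
    regroup = solve-∀

  g-+ : ∀ m n → G (suc (m + n)) ≡ G (suc n) * G (suc m) + β * G n * G m
  g-+ zero n = base β (G (suc n)) (G n)
    where
    base : ∀ β x y → x ≡ x * 1 + β * y * 0
    base = solve-∀
  g-+ (suc zero) n = base α β (G (suc n)) (G n)
    where
    base : ∀ α β x y → α * x + β * y ≡ x * (α * 1 + β * 0) + β * y * 1
    base = solve-∀
  g-+ (suc (suc m)) n = begin
    α * G (suc (suc m + n)) + β * G (suc (m + n))
      ≡⟨ cong₂ (λ x y → α * x + β * y) (g-+ (suc m) n) (g-+ m n) ⟩
    α * (G (suc n) * G (2 + m) + β * G n * G (suc m)) + β * (G (suc n) * G (suc m) + β * G n * G m)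
      ≡⟨ regroup α β (G (suc n)) (G n) (G (suc m)) (G m) ⟩
    G (suc n) * G (3 + m) + β * G n * G (2 + m) ∎
    where
    open ≡-Reasoning
    regroup : ∀ α β x y p q → α * (x * (α * p + β * q) + β * y * p) + β * (x * p + β * y * q)
                          ≡ x * (α * (α * p + β * q) + β * p) + β * y * (α * p + β * q)
    regroup = solve-∀

  CassiniEven CassiniOdd : ℕ → Set
  CassiniEven k = G (2 + k) * G k + β ^ k ≡ G (1 + k) * G (1 + k)
  CassiniOdd  k = G (2 + k) * G k ≡ G (1 + k) * G (1 + k) + β ^ k

  cassini-zero : CassiniEven 0
  cassini-zero = base α β
    where
    base : ∀ α β → (α * 1 + β * 0) * 0 + 1 ≡ 1 * 1
    base = solve-∀

  cassini-even⇒odd : ∀ k → CassiniEven k → CassiniOdd (suc k)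
  cassini-even⇒odd k even = begin
    G (3 + k) * G (1 + k)                                    ≡⟨ expand α β (G (1 + k)) (G k) ⟩
    α * G (2 + k) * G (1 + k) + β * (G (1 + k) * G (1 + k))  ≡⟨ cong (λ z → α * G (2 + k) * G (1 + k) + β * z) (sym even) ⟩
    α * G (2 + k) * G (1 + k) + β * (G (2 + k) * G k + β ^ k) ≡⟨ collect α β (G (1 + k)) (G k) (β ^ k) ⟩
    G (2 + k) * G (2 + k) + β * β ^ k                        ∎
    where
    open ≡-Reasoning
    expand : ∀ α β a b → (α * (α * a + β * b) + β * a) * a ≡ α * (α * a + β * b) * a + β * (a * a)
    expand = solve-∀
    collect : ∀ α β a b p → α * (α * a + β * b) * a + β * ((α * a + β * b) * b + p)
                            ≡ (α * a + β * b) * (α * a + β * b) + β * p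
    collect = solve-∀

  cassini-odd⇒even : ∀ k → CassiniOdd k → CassiniEven (suc k)
  cassini-odd⇒even k odd = begin
    G (3 + k) * G (1 + k) + β * β ^ k                          ≡⟨ expand α β (G (1 + k)) (G k) (β ^ k) ⟩
    α * G (2 + k) * G (1 + k) + β * (G (1 + k) * G (1 + k) + β ^ k) ≡⟨ cong (λ z → α * G (2 + k) * G (1 + k) + β * z) (sym odd) ⟩
    α * G (2 + k) * G (1 + k) + β * (G (2 + k) * G k)          ≡⟨ collect α β (G (1 + k)) (G k) ⟩
    G (2 + k) * G (2 + k)                                      ∎
    where
    open ≡-Reasoning
    expand : ∀ α β a b p → (α * (α * a + β * b) + β * a) * a + β * p
                           ≡ α * (α * a + β * b) * a + β * (a * a + p)
    expand = solve-∀
    collect : ∀ α β a b → α * (α * a + β * b) * a + β * ((α * a + β * b) * b)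
                          ≡ (α * a + β * b) * (α * a + β * b)
    collect = solve-∀

  cassini : ∀ k → CassiniEven k ⊎ CassiniOdd k
  cassini zero = inj₁ cassini-zero
  cassini (suc k) with cassini k
  ... | inj₁ even = inj₂ (cassini-even⇒odd k even)
  ... | inj₂ odd  = inj₁ (cassini-odd⇒even k odd)

  cassini-odd : ∀ j → CassiniOdd (suc (j + j))
  cassini-odd zero    = cassini-even⇒odd 0 cassini-zero
  cassini-odd (suc j) = subst (λ k → CassiniOdd (suc k)) (sym (+-suc (suc j) j))
    (cassini-even⇒odd (suc (suc (j + j))) (cassini-odd⇒even (suc (j + j)) (cassini-odd j)))

  g⊥β : Coprime α β → ∀ k → Coprime (G (suc k)) β
  g⊥β α⊥β zero    (d∣1 , _) = ∣1⇒≡1 d∣1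
  g⊥β α⊥β (suc k) {d} (d∣g , d∣β) = coprime-* α⊥β (g⊥β α⊥β k) (d∣αg , d∣β)
    where
    d∣αg : d ∣ α * G (suc k)
    d∣αg = ∣m+n∣m⇒∣n (subst (d ∣_) (+-comm (α * G (suc k)) (β * G k)) d∣g) (∣m⇒∣m*n (G k) d∣β)

  g⊥g : Coprime α β → ∀ k → Coprime (G (suc k)) (G k)
  g⊥g α⊥β zero    (d∣1 , _) = ∣1⇒≡1 d∣1
  g⊥g α⊥β (suc k) {d} (d∣g₂ , d∣g₁) = g⊥g α⊥β k (d∣g₁ , coprime-divisor d⊥β d∣βg₀)
    where
    d∣βg₀ : d ∣ β * G k
    d∣βg₀ = ∣m+n∣m⇒∣n d∣g₂ (∣n⇒∣m*n α d∣g₁)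
    d⊥β : Coprime d β
    d⊥β (e∣d , e∣β) = g⊥β α⊥β k (∣-trans e∣d d∣g₁ , e∣β)

  βg⊥g : Coprime α β → ∀ k → Coprime (β * G k) (G (suc k))
  βg⊥g α⊥β k = coprime-* (Coprime.sym (g⊥β α⊥β k)) (Coprime.sym (g⊥g α⊥β k))

  D E : ℕ
  D = α ^ 2 + 4 * β
  E = α ^ 2 + 2 * β

  -- lucas k = γ^k + λ^k and g k · √D = γ^k − λ^k, so BoundN bounds 2αDn by M (lucas k + g k √D).
  lucas : ℕ → ℕ
  lucas k = α * G k + 2 * β * G (k ∸ 1)

  lucas-even : ∀ t → lucas (2 + (t + t)) + E * (G (2 + t) * G t)
                     ≡ D * (G (2 + t) * G t) + E * (G (1 + t) * G (1 + t))
  lucas-even t = begin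
    α * G (2 + (t + t)) + 2 * β * G (1 + (t + t)) + E * (G (2 + t) * G t)
      ≡⟨ cong₂ (λ x y → α * x + 2 * β * y + E * (G (2 + t) * G t)) (g-+ (suc t) t) (g-+ t t) ⟩
    α * (G (1 + t) * G (2 + t) + β * G t * G (1 + t)) + 2 * β * (G (1 + t) * G (1 + t) + β * G t * G t)
      + E * (G (2 + t) * G t)
      ≡⟨ regroup α β (G (1 + t)) (G t) ⟩
    D * (G (2 + t) * G t) + E * (G (1 + t) * G (1 + t)) ∎
    where
    open ≡-Reasoning
    -- D and E unfold to α * (α * 1) + …; the ring solver cannot reflect _^_.
    regroup : ∀ α β a b → α * (a * (α * a + β * b) + β * b * a) + 2 * β * (a * a + β * b * b)
                            + (α * (α * 1) + 2 * β) * ((α * a + β * b) * b)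
                          ≡ (α * (α * 1) + 4 * β) * ((α * a + β * b) * b) + (α * (α * 1) + 2 * β) * (a * a)
    regroup = solve-∀

  lucas-even-≤ : ∀ t → lucas (2 + (t + t)) ≤ D * (G (2 + t) * G t) + E * β ^ t
  lucas-even-≤ t = +-cancelʳ-≤ (E * P) _ _ (begin
    lucas (2 + (t + t)) + E * P ≡⟨ lucas-even t ⟩
    D * P + E * Q               ≤⟨ +-monoʳ-≤ (D * P) (*-monoʳ-≤ E Q≤P+β^t) ⟩
    D * P + E * (P + β ^ t)     ≡⟨ regroup (D * P) E P (β ^ t) ⟩
    D * P + E * β ^ t + E * P   ∎)
    where
    open ≤-Reasoning
    P = G (2 + t) * G t
    Q = G (1 + t) * G (1 + t)
    Q≤P+β^t : Q ≤ P + β ^ t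
    Q≤P+β^t with cassini t
    ... | inj₁ even = ≤-reflexive (sym even)
    ... | inj₂ odd  = ≤-trans (m≤m+n Q (β ^ t)) (≤-trans (≤-reflexive (sym odd)) (m≤m+n P (β ^ t)))
    regroup : ∀ x e p b → x + e * (p + b) ≡ x + e * b + e * p
    regroup = solve-∀

  D*g²≤lucas² : ∀ t → D * (G (2 + (t + t)) * G (2 + (t + t))) ≤ lucas (2 + (t + t)) * lucas (2 + (t + t))
  D*g²≤lucas² t = +-cancelʳ-≤ (4 * β * X) _ _ (begin
    D * X + 4 * β * X                          ≤⟨ m≤m+n (D * X + 4 * β * X) (4 * β * β ^ suc (t + t)) ⟩
    D * X + 4 * β * X + 4 * β * β ^ suc (t + t) ≡⟨ regroup D (4 * β) X (β ^ suc (t + t)) ⟩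
    D * X + 4 * β * (X + β ^ suc (t + t))      ≡⟨ cong (λ z → D * X + 4 * β * z) (sym (cassini-odd t)) ⟩
    D * X + 4 * β * (G (3 + (t + t)) * y)       ≡⟨ square α β x y ⟩
    lucas (2 + (t + t)) * lucas (2 + (t + t)) + 4 * β * X ∎)
    where
    open ≤-Reasoning
    x = G (2 + (t + t))
    y = G (1 + (t + t))
    X = x * x
    regroup : ∀ d c x p → d * x + c * x + c * p ≡ d * x + c * (x + p)
    regroup = solve-∀
    square : ∀ α β x y → (α * (α * 1) + 4 * β) * (x * x) + 4 * β * ((α * x + β * y) * y)
                         ≡ (α * x + 2 * β * y) * (α * x + 2 * β * y) + 4 * β * (x * x)
    square = solve-∀

  module Monotone (1≤α : 1 ≤ α) where

    instance
      α≢0 : NonZero α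
      α≢0 = >-nonZero 1≤α

    g≤g-suc : ∀ k → G k ≤ G (suc k)
    g≤g-suc zero          = z≤n
    g≤g-suc (suc zero)    = ≤-trans (m≤n*m 1 α) (m≤m+n (α * 1) (β * 0))
    g≤g-suc (suc (suc k)) = ≤-trans (m≤n*m (G (2 + k)) α) (m≤m+n _ _)

    g-mono-≤ : ∀ {j k} → j ≤ k → G j ≤ G k
    g-mono-≤ {j} {k} j≤k = subst (λ i → G j ≤ G i) (m+[n∸m]≡n j≤k) (go (k ∸ j))
      where
      go : ∀ d → G j ≤ G (j + d)
      go zero    = ≤-reflexive (cong G (sym (+-identityʳ j)))
      go (suc d) = ≤-trans (go d) (subst (λ i → G (j + d) ≤ G i) (sym (+-suc j d)) (g≤g-suc (j + d)))

    0<g-suc : ∀ k → 0 < G (suc k)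
    0<g-suc k = g-mono-≤ {1} {suc k} (s≤s z≤n)

    g-suc-≤ : ∀ k → G (2 + k) ≤ (α + β) * G (1 + k)
    g-suc-≤ k = begin
      α * G (1 + k) + β * G k       ≤⟨ +-monoʳ-≤ (α * G (1 + k)) (*-monoʳ-≤ β (g≤g-suc k)) ⟩
      α * G (1 + k) + β * G (1 + k) ≡⟨ sym (*-distribʳ-+ (G (1 + k)) α β) ⟩
      (α + β) * G (1 + k)           ∎
      where open ≤-Reasoning

    β^≤g² : ∀ k → β ^ k ≤ G (2 + k) * G (2 + k)
    β^≤g² zero          = *-mono-≤ (0<g-suc 1) (0<g-suc 1)
    β^≤g² (suc zero)    = begin
      β * 1     ≤⟨ m≤n+m (β * G 1) (α * G 2) ⟩
      G 3       ≡⟨ sym (*-identityʳ (G 3)) ⟩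
      G 3 * 1   ≤⟨ *-monoʳ-≤ (G 3) (0<g-suc 2) ⟩
      G 3 * G 3 ∎
      where open ≤-Reasoning
    β^≤g² (suc (suc k)) = begin
      β * (β * β ^ k)                   ≤⟨ *-monoʳ-≤ β (*-monoʳ-≤ β (β^≤g² k)) ⟩
      β * (β * (G (2 + k) * G (2 + k))) ≡⟨ regroup β (G (2 + k)) ⟩
      (β * G (2 + k)) * (β * G (2 + k)) ≤⟨ *-mono-≤ βg≤g βg≤g ⟩
      G (4 + k) * G (4 + k)             ∎
      where
      open ≤-Reasoning
      βg≤g : β * G (2 + k) ≤ G (4 + k)
      βg≤g = m≤n+m (β * G (2 + k)) (α * G (3 + k))
      regroup : ∀ b x → b * (b * (x * x)) ≡ (b * x) * (b * x)
      regroup = solve-∀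

    lucas-even-≤-g : ∀ r → lucas (2 + (suc r + suc r)) ≤ D * (G (4 + r) * G (2 + r))
    lucas-even-≤-g r = begin
      lucas (2 + (suc r + suc r))                                 ≤⟨ lucas-even-≤ (suc r) ⟩
      D * (G (3 + r) * G (1 + r)) + E * (β * β ^ r)               ≤⟨ +-monoʳ-≤ (D * _) (*-mono-≤ E≤D (*-monoʳ-≤ β (β^≤g² r))) ⟩
      D * (G (3 + r) * G (1 + r)) + D * (β * (G (2 + r) * G (2 + r))) ≡⟨ sym (*-distribˡ-+ D _ _) ⟩
      D * (G (3 + r) * G (1 + r) + β * (G (2 + r) * G (2 + r)))   ≤⟨ *-monoʳ-≤ D inner ⟩
      D * (G (4 + r) * G (2 + r))                                 ∎
      where
      open ≤-Reasoning
      E≤D : E ≤ D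
      E≤D = +-monoʳ-≤ (α ^ 2) (*-monoˡ-≤ β {2} {4} (s≤s (s≤s z≤n)))
      regroup : ∀ a b c → a * b + c * (b * b) ≡ (a + c * b) * b
      regroup = solve-∀
      inner : G (3 + r) * G (1 + r) + β * (G (2 + r) * G (2 + r)) ≤ G (4 + r) * G (2 + r)
      inner = begin
        G (3 + r) * G (1 + r) + β * (G (2 + r) * G (2 + r)) ≤⟨ +-monoˡ-≤ _ (*-monoʳ-≤ (G (3 + r)) (g≤g-suc (1 + r))) ⟩
        G (3 + r) * G (2 + r) + β * (G (2 + r) * G (2 + r)) ≡⟨ regroup (G (3 + r)) (G (2 + r)) β ⟩
        (G (3 + r) + β * G (2 + r)) * G (2 + r)             ≤⟨ *-monoˡ-≤ (G (2 + r)) (+-monoˡ-≤ _ (m≤n*m (G (3 + r)) α)) ⟩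
        G (4 + r) * G (2 + r)                               ∎

BalancedSolution : (α β u v m n : ℕ) → Set
BalancedSolution α β u v m n =
  ∃₂ λ A₁ A₂ → A₁ ≤ β * u × 1 + m * (β * v) ≤ A₂ × A₂ ≤ α * A₁ × β * v * A₁ + u * A₂ ≡ n

balanced⇒bounds : ∀ {α β u v m n} → BalancedSolution α β u v m n →
                  m * v < α * u × (α * u + β * v) * (1 + m * (β * v)) ≤ α * n
balanced⇒bounds {α} {β} {u} {v} {m} {n} (A₁ , A₂ , A₁≤ , A₂-large , A₂≤ , solves) = m*v<α*u , g*large≤α*n
  where
  m*v<α*u : m * v < α * u
  m*v<α*u = *-cancelˡ-< β (m * v) (α * u) (begin-strict
    β * (m * v)   ≡⟨ regroup₁ β m v ⟩
    m * (β * v)   <⟨ A₂-large ⟩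
    A₂            ≤⟨ A₂≤ ⟩
    α * A₁        ≤⟨ *-monoʳ-≤ α A₁≤ ⟩
    α * (β * u)   ≡⟨ regroup₂ α β u ⟩
    β * (α * u)   ∎)
    where
    open ≤-Reasoning
    regroup₁ : ∀ β m v → β * (m * v) ≡ m * (β * v)
    regroup₁ = solve-∀
    regroup₂ : ∀ α β u → α * (β * u) ≡ β * (α * u)
    regroup₂ = solve-∀
  g*large≤α*n : (α * u + β * v) * (1 + m * (β * v)) ≤ α * n
  g*large≤α*n = begin
    (α * u + β * v) * (1 + m * (β * v)) ≤⟨ *-monoʳ-≤ (α * u + β * v) A₂-large ⟩
    (α * u + β * v) * A₂                ≡⟨ regroup₁ α β u v A₂ ⟩
    β * v * A₂ + α * u * A₂             ≤⟨ +-monoˡ-≤ (α * u * A₂) (*-monoʳ-≤ (β * v) A₂≤) ⟩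
    β * v * (α * A₁) + α * u * A₂       ≡⟨ regroup₂ α β v u A₁ A₂ ⟩
    α * (β * v * A₁ + u * A₂)           ≡⟨ cong (α *_) solves ⟩
    α * n                               ∎
    where
    open ≤-Reasoning
    regroup₁ : ∀ α β u v A → (α * u + β * v) * A ≡ β * v * A + α * u * A
    regroup₁ = solve-∀
    regroup₂ : ∀ α β v u A₁ A₂ → β * v * (α * A₁) + α * u * A₂ ≡ α * (β * v * A₁ + u * A₂)
    regroup₂ = solve-∀

module Walks (α β : ℕ) (1≤α : 1 ≤ α) (1≤β : 1 ≤ β) (α⊥β : Coprime α β) where
  open Recurrence α β
  open Monotone 1≤α

  s-unique : ∀ {n s s'} → IsS α β n s → IsS α β n s' → s ≡ s'
  s-unique (1≤s , (a₁ , a₂ , 1≤a₁ , 1≤a₂ , w) , s-max) (1≤s' , (b₁ , b₂ , 1≤b₁ , 1≤b₂ , w') , s'-max) =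
    ≤-antisym (s'-max a₁ a₂ _ 1≤a₁ 1≤a₂ 1≤s w) (s-max b₁ b₂ _ 1≤b₁ 1≤b₂ 1≤s' w')

  good⇒solution : ∀ {n t a₁ a₂} → IsS α β n (2 + t) → Good α β n (a₁ , a₂) →
                  β * G t * a₁ + G (1 + t) * a₂ ≡ n
  good⇒solution {n} {t} {a₁} {a₂} s≡2+t (_ , _ , s , s≡s , w) =
    trans (sym (walk-closed-form a₁ a₂ t)) (subst (λ i → walk α β a₁ a₂ i ≡ n) (s-unique s≡s s≡2+t) w)

  large-good-pair : ∀ {n t} q → 1 ≤ t → IsS α β n (2 + t) → PGt α β n q →
                    ∃₂ λ a₁ a₂ → 1 ≤ a₁ × q * (β * G t) < a₂ × β * G t * a₁ + G (1 + t) * a₂ ≡ n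
  large-good-pair {n} {t} q 1≤t s≡2+t (f , f-inj , good) =
    let (i , large) = large-solution q (βg⊥g α⊥β t) f f-inj (λ i → proj₁ (proj₂ (good i)))
                        (λ i → good⇒solution s≡2+t (good i))
    in proj₁ (f i) , proj₂ (f i) , proj₁ (good i) , large , good⇒solution s≡2+t (good i)
    where
    instance
      βg≢0 : NonZero (β * G t)
      βg≢0 = >-nonZero (*-mono-≤ 1≤β (g-mono-≤ 1≤t))

  -- Otherwise ((A₂ − α A₁) / β , A₁ , A₂ , …) would reach n one step later than s(n).
  no-backward-step : ∀ {n t A₁ A₂} → IsS α β n (2 + t) → 1 ≤ A₁ → β * G t * A₁ + G (1 + t) * A₂ ≡ n →
                     A₂ ≡ α * A₁ mod β → A₂ ≤ α * A₁
  no-backward-step {n} {t} {A₁} {A₂} (_ , _ , s-max) 1≤A₁ eq A₂≡αA₁ = ≮⇒≥ λ αA₁<A₂ →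
    let (d , A₂≡) = ≡-mod-gap A₂≡αA₁ αA₁<A₂
        longer : walk α β (suc d) A₁ (3 + t) ≡ n
        longer = begin
          walk α β (suc d) A₁ (3 + t)                            ≡⟨ walk-prepend (suc d) A₁ (1 + t) ⟩
          walk α β A₁ (α * A₁ + β * suc d) (2 + t)               ≡⟨ walk-closed-form A₁ _ t ⟩
          β * G t * A₁ + G (1 + t) * (α * A₁ + β * suc d)        ≡⟨ cong (λ z → β * G t * A₁ + G (1 + t) * (α * A₁ + z)) (*-comm β (suc d)) ⟩
          β * G t * A₁ + G (1 + t) * (α * A₁ + suc d * β)        ≡⟨ cong (λ z → β * G t * A₁ + G (1 + t) * z) (sym A₂≡) ⟩
          β * G t * A₁ + G (1 + t) * A₂                          ≡⟨ eq ⟩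
          n                                                      ∎
    in <-irrefl refl (s-max (suc d) A₁ (3 + t) (s≤s z≤n) 1≤A₁ (s≤s z≤n) longer)
    where open ≡-Reasoning

  aligned-solution : ∀ {n t q x a₂} → β ≤ q → 1 ≤ x → x ≤ G (1 + t) → q * (β * G t) < a₂ →
                     β * G t * x + G (1 + t) * a₂ ≡ n →
                     ∃₂ λ A₁ A₂ → 1 ≤ A₁ × A₁ ≤ β * G (1 + t) × 1 + (q ∸ β + 1) * (β * G t) ≤ A₂
                                × A₂ ≡ α * A₁ mod β × β * G t * A₁ + G (1 + t) * A₂ ≡ n
  aligned-solution {n} {t} {q} {x} {a₂} β≤q 1≤x x≤u qM<a₂ eq
    with residue 1≤β (coprime-* α⊥β (g⊥β α⊥β t)) (α * x) a₂
  ... | j , j<β , k , l , eq-j =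
    x + j * u , A₂ , ≤-trans 1≤x (m≤m+n x _) , A₁≤βu , A₂-large , A₂≡αA₁ , solves
    where
    u = G (1 + t)
    v = G t
    M = β * v
    A₁≤βu : x + j * u ≤ β * u
    A₁≤βu = ≤-trans (+-monoˡ-≤ (j * u) x≤u) (*-monoˡ-≤ u j<β)
    jM≤a₂ : j * M ≤ a₂
    jM≤a₂ = ≤-trans (*-monoˡ-≤ M (≤-trans (<⇒≤ j<β) β≤q)) (<⇒≤ qM<a₂)
    A₂ = a₂ ∸ j * M
    A₂+jM≡a₂ : A₂ + j * M ≡ a₂
    A₂+jM≡a₂ = m∸n+n≡m jM≤a₂
    solves : M * (x + j * u) + u * A₂ ≡ n
    solves = trans (regroup₁ M u x j A₂) (trans (cong (λ z → M * x + u * z) A₂+jM≡a₂) eq)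
      where
      regroup₁ : ∀ M u x j A₂ → M * (x + j * u) + u * A₂ ≡ M * x + u * (A₂ + j * M)
      regroup₁ = solve-∀
    A₂≡αA₁ : A₂ ≡ α * (x + j * u) mod β
    A₂≡αA₁ = j * v + l , k , (begin
      A₂ + (j * v + l) * β        ≡⟨ regroup₂ A₂ j v l β ⟩
      A₂ + j * (β * v) + l * β    ≡⟨ cong (_+ l * β) A₂+jM≡a₂ ⟩
      a₂ + l * β                  ≡⟨ sym eq-j ⟩
      α * x + j * (α * u) + k * β ≡⟨ cong (_+ k * β) (regroup₃ α x j u) ⟩
      α * (x + j * u) + k * β     ∎)
      where
      open ≡-Reasoning
      regroup₂ : ∀ A₂ j v l β → A₂ + (j * v + l) * β ≡ A₂ + j * (β * v) + l * β
      regroup₂ = solve-∀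
      regroup₃ : ∀ α x j u → α * x + j * (α * u) ≡ α * (x + j * u)
      regroup₃ = solve-∀
    A₂-large : 1 + (q ∸ β + 1) * M ≤ A₂
    A₂-large = +-cancelʳ-≤ (j * M) _ _ (begin
      1 + (q ∸ β + 1) * M + j * M ≡⟨ regroup₄ (q ∸ β) j M ⟩
      1 + (q ∸ β + suc j) * M     ≤⟨ s≤s (*-monoˡ-≤ M (≤-trans (+-monoʳ-≤ (q ∸ β) j<β) (≤-reflexive (m∸n+n≡m β≤q)))) ⟩
      1 + q * M                   ≤⟨ qM<a₂ ⟩
      a₂                          ≡⟨ sym A₂+jM≡a₂ ⟩
      A₂ + j * M                  ∎)
      where
      open ≤-Reasoning
      regroup₄ : ∀ p j M → 1 + (p + 1) * M + j * M ≡ 1 + (p + suc j) * M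
      regroup₄ = solve-∀

  balanced-solution : ∀ {n t} q → 1 ≤ t → β ≤ q → IsS α β n (2 + t) → PGt α β n q →
                      BalancedSolution α β (G (1 + t)) (G t) (q ∸ β + 1) n
  balanced-solution {n} {t} q 1≤t β≤q s≡2+t pgt
    with large-good-pair q 1≤t s≡2+t pgt
  ... | a₁ , a₂ , 1≤a₁ , large , eq
    with first-coordinate-≤ (β * G t) (G (1 + t)) {{>-nonZero (0<g-suc t)}} 1≤a₁ eq
  ... | x , a₂' , 1≤x , x≤u , a₂≤a₂' , eq'
    with aligned-solution {t = t} β≤q 1≤x x≤u (<-≤-trans large a₂≤a₂') eq'
  ... | A₁ , A₂ , 1≤A₁ , A₁≤ , A₂-large , A₂≡αA₁ , solves
    = A₁ , A₂ , A₁≤ , A₂-large , no-backward-step {t = t} s≡2+t 1≤A₁ solves A₂≡αA₁ , solves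

  key-inequalities : ∀ {n t} q → 1 ≤ t → β ≤ q → IsS α β n (2 + t) → PGt α β n q →
                     (q ∸ β + 1) * G t < α * G (1 + t) × G (2 + t) * (1 + (q ∸ β + 1) * (β * G t)) ≤ α * n
  key-inequalities {n} {t} q 1≤t β≤q s≡2+t pgt =
    balanced⇒bounds {α} {β} {G (1 + t)} {G t} {q ∸ β + 1} {n} (balanced-solution q 1≤t β≤q s≡2+t pgt)

module Counting (α β : ℕ) (1≤α : 1 ≤ α) (1≤β : 1 ≤ β) (α⊥β : Coprime α β) where
  open Recurrence α β
  open Monotone 1≤α
  open Walks α β 1≤α 1≤β α⊥β

  1≤D : 1 ≤ D
  1≤D = ≤-trans (*-mono-≤ 1≤α (*-mono-≤ 1≤α (≤-refl {1}))) (m≤m+n (α ^ 2) (4 * β))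

  instance
    αD≢0 : NonZero (α * D)
    αD≢0 = >-nonZero (*-mono-≤ 1≤α 1≤D)

  BoundN⇒≤ : ∀ q r n → BoundN α β q r n → α * D * n ≤ β * (q ∸ β + 1) * lucas (2 + (r + r))
  BoundN⇒≤ q r n bound = *-cancelˡ-≤ 2 (begin
    2 * (α * D * n) ≡⟨ regroup₁ α D n ⟩
    2 * α * D * n   ≤⟨ LeSqrt⇒≤+ {2 * α * D * n} {M * L} {M * Y} {D} DY²≤L² bound′ ⟩
    M * L + M * L   ≡⟨ regroup₂ (M * L) ⟩
    2 * (M * L)     ∎)
    where
    open ≤-Reasoning
    M = β * (q ∸ β + 1)
    L = lucas (2 + (r + r))
    Y = G (2 + (r + r))
    bound′ : LeSqrt (2 * α * D * n) (M * L) (M * Y) D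
    bound′ = subst (λ k → LeSqrt (2 * α * D * n) (M * lucas k) (M * G k) D) (index r) bound
      where
      index : ∀ r → 2 * r + 2 ≡ 2 + (r + r)
      index = solve-∀
    DY²≤L² : D * ((M * Y) * (M * Y)) ≤ (M * L) * (M * L)
    DY²≤L² = begin
      D * ((M * Y) * (M * Y)) ≡⟨ regroup₃ D M Y ⟩
      (M * M) * (D * (Y * Y)) ≤⟨ *-monoʳ-≤ (M * M) (D*g²≤lucas² r) ⟩
      (M * M) * (L * L)       ≡⟨ regroup₄ M L ⟩
      (M * L) * (M * L)       ∎
      where
      regroup₃ : ∀ D M Y → D * ((M * Y) * (M * Y)) ≡ (M * M) * (D * (Y * Y))
      regroup₃ = solve-∀
      regroup₄ : ∀ M L → (M * M) * (L * L) ≡ (M * L) * (M * L)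
      regroup₄ = solve-∀
    regroup₁ : ∀ α D n → 2 * (α * D * n) ≡ 2 * α * D * n
    regroup₁ = solve-∀
    regroup₂ : ∀ x → x + x ≡ 2 * x
    regroup₂ = solve-∀

  lower-bound : ∀ {n t} q → 1 ≤ t → β ≤ q → IsS α β n (2 + t) → PGt α β n q →
                D * G (2 + t) + β * (q ∸ β + 1) * (D * (G (2 + t) * G t)) ≤ α * D * n
  lower-bound {n} {t} q 1≤t β≤q s≡2+t pgt = begin
    D * G (2 + t) + β * m * (D * (G (2 + t) * G t)) ≡⟨ regroup₁ D (G (2 + t)) β m (G t) ⟩
    D * (G (2 + t) * (1 + m * (β * G t)))           ≤⟨ *-monoʳ-≤ D (proj₂ (key-inequalities q 1≤t β≤q s≡2+t pgt)) ⟩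
    D * (α * n)                                     ≡⟨ regroup₂ D α n ⟩
    α * D * n                                       ∎
    where
    open ≤-Reasoning
    m = q ∸ β + 1
    regroup₁ : ∀ D y β m v → D * y + β * m * (D * (y * v)) ≡ D * (y * (1 + m * (β * v)))
    regroup₁ = solve-∀
    regroup₂ : ∀ D α n → D * (α * n) ≡ α * D * n
    regroup₂ = solve-∀

  index-pinned : ∀ {x r t m} → 1 ≤ r → r ≤ t →
                 D * G (2 + t) + β * m * (D * (G (2 + t) * G t)) ≤ x → x ≤ β * m * lucas (2 + (r + r)) → t ≡ r
  index-pinned {x} {suc r} {t} {m} _ r≤t lower upper with m≤n⇒m<n∨m≡n r≤t
  ... | inj₂ r≡t = sym r≡t
  ... | inj₁ r<t = ⊥-elim (<⇒≱ (begin-strict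
    β * m * lucas (2 + (suc r + suc r))              ≤⟨ *-monoʳ-≤ (β * m) (lucas-even-≤-g r) ⟩
    β * m * (D * (G (4 + r) * G (2 + r)))             ≤⟨ *-monoʳ-≤ (β * m) (*-monoʳ-≤ D (*-mono-≤ (g-mono-≤ (s≤s (s≤s r<t))) (g-mono-≤ r<t))) ⟩
    β * m * (D * (G (2 + t) * G t))                   <⟨ m<n+m _ (*-mono-≤ 1≤D (0<g-suc (suc t))) ⟩
    D * G (2 + t) + β * m * (D * (G (2 + t) * G t))   ≤⟨ lower ⟩
    x                                                 ∎) upper)
    where open ≤-Reasoning

  multiplicity-bound : ∀ {q t} → 1 ≤ t → (q ∸ β + 1) * G t < α * G (1 + t) → q ∸ β + 1 < α * (α + β)
  multiplicity-bound {q} {suc t} _ m*v<α*u = *-cancelʳ-< (G (suc t)) _ _ (begin-strict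
    (q ∸ β + 1) * G (1 + t)     <⟨ m*v<α*u ⟩
    α * G (2 + t)               ≤⟨ *-monoʳ-≤ α (g-suc-≤ t) ⟩
    α * ((α + β) * G (1 + t))   ≡⟨ sym (*-assoc α (α + β) (G (1 + t))) ⟩
    α * (α + β) * G (1 + t)     ∎)
    where open ≤-Reasoning

  C : ℕ
  C = α * (α + β) * β * E

  αDn-in-window : ∀ r q n → 2 ≤ r → β ≤ q → PGt α β n q → BoundN α β q r n → TGt α β n r →
           β * (q ∸ β + 1) * (D * (G (2 + r) * G r)) < α * D * n
           × α * D * n ≤ β * (q ∸ β + 1) * (D * (G (2 + r) * G r)) + C * β ^ r
  αDn-in-window r q n 2≤r β≤q pgt bound (suc (suc t) , s≡2+t , s≤s (s≤s r≤t)) = above , below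
    where
    1≤r : 1 ≤ r
    1≤r = ≤-trans (s≤s z≤n) 2≤r
    t≡r : t ≡ r
    t≡r = index-pinned 1≤r r≤t (lower-bound q (≤-trans 1≤r r≤t) β≤q s≡2+t pgt) (BoundN⇒≤ q r n bound)
    s≡2+r : IsS α β n (2 + r)
    s≡2+r = subst (λ i → IsS α β n (2 + i)) t≡r s≡2+t
    m = q ∸ β + 1
    B = β * m * (D * (G (2 + r) * G r))
    above : B < α * D * n
    above = <-≤-trans (m<n+m B (*-mono-≤ 1≤D (0<g-suc (suc r)))) (lower-bound q 1≤r β≤q s≡2+r pgt)
    m<α[α+β] : m < α * (α + β)
    m<α[α+β] = multiplicity-bound 1≤r (proj₁ (key-inequalities q 1≤r β≤q s≡2+r pgt))
    below : α * D * n ≤ B + C * β ^ r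
    below = begin
      α * D * n                                   ≤⟨ BoundN⇒≤ q r n bound ⟩
      β * m * lucas (2 + (r + r))                 ≤⟨ *-monoʳ-≤ (β * m) (lucas-even-≤ r) ⟩
      β * m * (D * (G (2 + r) * G r) + E * β ^ r) ≡⟨ *-distribˡ-+ (β * m) _ _ ⟩
      B + β * m * (E * β ^ r)                     ≤⟨ +-monoʳ-≤ B (*-monoˡ-≤ (E * β ^ r) (*-monoʳ-≤ β (<⇒≤ m<α[α+β]))) ⟩
      B + β * (α * (α + β)) * (E * β ^ r)         ≡⟨ cong (B +_) (regroup β (α * (α + β)) E (β ^ r)) ⟩
      B + C * β ^ r                               ∎
      where
      open ≤-Reasoning
      regroup : ∀ b a e p → b * a * (e * p) ≡ a * b * e * p
      regroup = solve-∀

  few-with-large-index : ∀ r q → 2 ≤ r → β ≤ q →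
    AtMost (C * β ^ r) (λ n → 1 ≤ n × PGt α β n q × BoundN α β q r n × TGt α β n r)
  few-with-large-index r q 2≤r β≤q =
    AtMost-window {λ n → 1 ≤ n × PGt α β n q × BoundN α β q r n × TGt α β n r}
      (α * D) (β * (q ∸ β + 1) * (D * (G (2 + r) * G r))) (C * β ^ r)
      λ n (_ , pgt , bound , tgt) → αDn-in-window r q n 2≤r β≤q pgt bound tgt

  bounded-index : ∀ r n → 2 ≤ r → PGt α β n β → n ≤ β * G r * G (r + 1) → TLe α β n r
  bounded-index r n 2≤r pgt@(f , _ , good) n≤ = decide (proj₁ (proj₂ (proj₂ (proj₂ (good fzero)))))
    where
    not-large : ∀ {s} → IsS α β n s → 2 + r ≤ s → ⊥
    not-large {suc (suc t)} s≡2+t (s≤s (s≤s r≤t)) =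
      case large-good-pair β (≤-trans (≤-trans (s≤s z≤n) 2≤r) r≤t) s≡2+t pgt of λ where
        (a₁ , a₂ , _ , ββv<a₂ , solves) → <⇒≱ (begin-strict
          β * G r * G (r + 1)           ≤⟨ *-mono-≤ (*-monoʳ-≤ β (g-mono-≤ r≤t)) (g-mono-≤ (≤-trans (≤-reflexive (+-comm r 1)) (s≤s r≤t))) ⟩
          β * G t * G (1 + t)           ≡⟨ *-comm (β * G t) (G (1 + t)) ⟩
          G (1 + t) * (β * G t)         <⟨ *-monoʳ-< (G (1 + t)) {{>-nonZero (0<g-suc t)}}
                                             (≤-<-trans (m≤n*m (β * G t) β {{>-nonZero 1≤β}}) ββv<a₂) ⟩
          G (1 + t) * a₂                ≤⟨ m≤n+m _ _ ⟩
          β * G t * a₁ + G (1 + t) * a₂ ≡⟨ solves ⟩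
          n                             ∎) n≤
      where open ≤-Reasoning
    decide : ∀ {s} → IsS α β n s → TLe α β n r
    decide {s} s≡ = [ (λ s≤1+r → s , s≡ , s≤1+r) , (λ 1+r<s → ⊥-elim (not-large s≡ 1+r<s)) ]′ (≤-<-connex s (suc r))

lemma8 : (α β : ℕ) → 1 ≤ α → 1 ≤ β → Coprime α β →
    (∃[ C ] ∀ (r q : ℕ) → 2 ≤ r → β ≤ q →
        AtMost (C * β ^ r)
          (λ n → 1 ≤ n × PGt α β n q × BoundN α β q r n × TGt α β n r))
    × (∀ (r n : ℕ) → 2 ≤ r → 1 ≤ n → PGt α β n β →
        n ≤ β * g α β r * g α β (r + 1) → TLe α β n r)
lemma8 α β 1≤α 1≤β α⊥β = (C , few-with-large-index) , λ r n 2≤r _ → bounded-index r n 2≤r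
  where open Counting α β 1≤α 1≤β α⊥β
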